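{- Neither the class of $\lambda$-ho-term-graphs over $\Sigma^\lambda_1$ nor the class of $\lambda$-ap-ho-term-graphs over $\Sigma^\lambda_1$ is closed under functional bisimulations on the underlying term graphs. That is, there exist: - a $\lambda$-ho-term-graph $\mathcal G$ over $\Sigma^\lambda_1$; - a term graph $G'$ over $\Sigma^\lambda_1$; - a homomorphism $h$ from the term graph underlying $\mathcal G$ to $G'$, such that there is no $\lambda$-ho-term-graph $\mathcal G'$ with underlying term graph $G'$ for which $h$ is a homomorphism from $\mathcal G$ to $\mathcal G'$. The analogous statement holds for $\lambda$-ap-ho-term-graphs over $\Sigma^\lambda_1$.
   Context: Term graphs. A term graph over a signature $\Sigma$ is a tuple $(V,\mathit{lab},\mathit{args},r)$, where: - $\mathit{args}(v)\in V^*$ has length equal to the arity of $\mathit{lab}(v)$; - every vertex is reachable from the root $r$. Write $w\rightarrowtail_kw'$ if $w'$ is the $k$-th entry (from $0$) of $\mathit{args}(w)$. Homomorphisms. A term-graph homomorphism $h$ satisfies $h(r_1)=r_2$, preserves labels, and has $\mathit{args}_2(h(v))=\bar h(\mathit{args}_1(v))$, with $\bar h$ the letterwise extension. Notation. $\Sigma^\lambda_1=\{@,\lambda,0\}$ with arities $2,1,1$, and $V(\lambda)$ denotes the $\lambda$-labelled vertices. For words: $\epsilon$ is empty, juxtaposition is concatenation, $\le$ is the prefix order. $\lambda$-ho-term-graphs. A $\lambda$-ho-term-graph over $\Sigma^\lambda_1$ is $(V,\mathit{lab},\mathit{args},r,\mathit{Sc})$, with $(V,\mathit{lab},\mathit{args},r)$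 (its underlying term graph) a term graph over $\Sigma^\lambda_1$ and $\mathit{Sc}:V(\lambda)\to\mathcal P(V)$. Writing $\mathit{Sc}^-(v)=\mathit{Sc}(v)\setminus\{v\}$, for all $k$, $w,w_0,w_1\in V$ and $v,v_0,v_1\in V(\lambda)$: - $r\notin\mathit{Sc}^-(v)$; - $v\in\mathit{Sc}(v)$; - $v_1\in\mathit{Sc}^-(v_0)$ implies $\mathit{Sc}(v_1)\subseteq\mathit{Sc}^-(v_0)$; - $w\rightarrowtail_kw_k$ and $w_k\in\mathit{Sc}^-(v)$ imply $w\in\mathit{Sc}(v)$; - a $0$-labelled $w$ lies in some $\mathit{Sc}^-(v_0)$; - $\mathit{lab}(w)=0$ and $w\rightarrowtail_0w_0$ imply $w_0\in V(\lambda)$ and, for all $v$, ($w\in\mathit{Sc}(v)\iff w_0\in\mathit{Sc}(v)$). A homomorphism of such graphs is a term-graph homomorphism $h$ with $\{h(u):u\in\mathit{Sc}_1(v)\}=\mathit{Sc}_2(h(v))$ for all $v\in V_1(\lambda)$. $\lambda$-ap-ho-term-graphs. A $\lambda$-ap-ho-term-graph over $\Sigma^\lambda_1$ is $(V,\mathit{lab},\mathit{args},r,P)$ with $P:V\to V^*$ such that: - $P(r)=\epsilon$; - $\lambda$-vertex $w\rightarrowtail_0w_0$ implies $P(w_0)\le P(w)w$; - $@$-vertex $w\rightarrowtail_kw_k$ implies $P(w_k)\le P(w)$; - $0$-vertex $w$ implies $P(w)\neq\epsilon$; - $0$-vertex $w\rightarrowtail_0w_0$ implies $\mathit{lab}(w_0)=\lambda$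 and $P(w_0)w_0=P(w)$. Its homomorphisms are term-graph homomorphisms with $P_2(h(w))=\bar h(P_1(w))$. -}

module Defs where

open import Data.Nat using (ℕ; zero; suc)
open import Data.List using (List; []; _∷_; length; map; _++_; [_])
open import Data.List.Relation.Binary.Prefix.Heterogeneous using (Prefix)
open import Data.Product using (Σ; ∃; _×_; _,_)
open import Relation.Binary.PropositionalEquality using (_≡_; _≢_)
open import Relation.Nullary using (¬_)
open import Level using (Level) renaming (suc to lsuc; zero to lzero)

data Lab : Set where
  app lam var0 : Lab

arity : Lab → ℕ
arity app  = 2
arity lam  = 1
arity var0 = 1

data At {V : Set} : List V → ℕ → V → Set where
  here  : ∀ {x xs} → At (x ∷ xs) zero x
  there : ∀ {x y xs k} → At xs k y → At (x ∷ xs) (suc k) y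

_≤ₚ_ : {V : Set} → List V → List V → Set
xs ≤ₚ ys = Prefix _≡_ xs ys

data Reach {V : Set} (args : V → List V) (r : V) : V → Set where
  reach-root : Reach args r r
  reach-step : ∀ {w k w'} → Reach args r w → At (args w) k w' → Reach args r w'

record TermGraph : Set₁ where
  field
    V         : Set
    lab       : V → Lab
    args      : V → List V
    args-len  : ∀ v → length (args v) ≡ arity (lab v)
    root      : V
    reachable : ∀ v → Reach args root v

  _↣[_]_ : V → ℕ → V → Set
  w ↣[ k ] w' = At (args w) k w'

open TermGraph public

record IsHom (G₁ G₂ : TermGraph) (h : V G₁ → V G₂) : Set where
  field
    hom-root : h (root G₁) ≡ root G₂
    hom-lab  : ∀ v → lab G₂ (h v) ≡ lab G₁ v
    hom-args : ∀ v → args G₂ (h v) ≡ map h (args G₁ v)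

-- λ-ho-term-graphs: scope function Sc : V(λ) → P(V), represented as a
-- predicate-valued function Sc : V → (V → Set) that is only constrained
-- (and only consulted) at λ-labelled vertices.

module _ (G : TermGraph) where
  private
    W = V G

  IsV-lam : W → Set
  IsV-lam v = lab G v ≡ lam

  Sc⁻ : (W → W → Set) → W → W → Set
  Sc⁻ Sc v w = Sc v w × w ≢ v

  record IsScopeFunction (Sc : W → W → Set) : Set where
    field
      sc-root  : ∀ v → IsV-lam v → ¬ Sc⁻ Sc v (root G)
      sc-self  : ∀ v → IsV-lam v → Sc v v
      sc-nest  : ∀ v₀ v₁ → IsV-lam v₀ → IsV-lam v₁ →
                 Sc⁻ Sc v₀ v₁ → ∀ u → Sc v₁ u → Sc⁻ Sc v₀ u
      sc-close : ∀ v w k wₖ → IsV-lam v →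
                 _↣[_]_ G w k wₖ → Sc⁻ Sc v wₖ → Sc v w
      sc-var   : ∀ w → lab G w ≡ var0 →
                 Σ W (λ v₀ → IsV-lam v₀ × Sc⁻ Sc v₀ w)
      sc-var-lam : ∀ w w₀ → lab G w ≡ var0 → _↣[_]_ G w 0 w₀ →
                 IsV-lam w₀ ×
                 (∀ v → IsV-lam v → (Sc v w → Sc v w₀) × (Sc v w₀ → Sc v w))

  record IsAbsPrefixFunction (P : W → List W) : Set where
    field
      ap-root : P (root G) ≡ []
      ap-lam  : ∀ w w₀ → lab G w ≡ lam → _↣[_]_ G w 0 w₀ →
                P w₀ ≤ₚ (P w ++ [ w ])
      ap-app  : ∀ w k wₖ → lab G w ≡ app → _↣[_]_ G w k wₖ →
                P wₖ ≤ₚ P w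
      ap-var  : ∀ w → lab G w ≡ var0 → P w ≢ []
      ap-var-lam : ∀ w w₀ → lab G w ≡ var0 → _↣[_]_ G w 0 w₀ →
                lab G w₀ ≡ lam × (P w₀ ++ [ w₀ ]) ≡ P w

IsHoHom : (G₁ G₂ : TermGraph) (Sc₁ : V G₁ → V G₁ → Set)
          (Sc₂ : V G₂ → V G₂ → Set) (h : V G₁ → V G₂) → Set
IsHoHom G₁ G₂ Sc₁ Sc₂ h =
  IsHom G₁ G₂ h ×
  (∀ v → lab G₁ v ≡ lam → ∀ x →
     (Sc₂ (h v) x → Σ (V G₁) (λ u → Sc₁ v u × h u ≡ x)) ×
     (Σ (V G₁) (λ u → Sc₁ v u × h u ≡ x) → Sc₂ (h v) x))

IsApHom : (G₁ G₂ : TermGraph) (P₁ : V G₁ → List (V G₁))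
          (P₂ : V G₂ → List (V G₂)) (h : V G₁ → V G₂) → Set
IsApHom G₁ G₂ P₁ P₂ h =
  IsHom G₁ G₂ h × (∀ w → P₂ (h w) ≡ map h (P₁ w))

-- The term graph G of (λx.λy.y)(λz.z) shares nothing; G' shares the two
-- identical subterms λy.y and λz.z, and the sharing map is a term-graph
-- homomorphism. The scope of λx contains λy, so in G' it would contain the
-- shared vertex, which is also an argument of the root application; closure of
-- scopes under predecessors then puts the root into a proper scope. Likewise the
-- abstraction prefixes [λx] of λy and [] of λz would both have to be the prefix of
-- the shared vertex.
module Submission where

open import Data.List using (List; []; _∷_; length; map)
open import Data.Product using (Σ; _×_; _,_; proj₂)
open import Data.Empty using (⊥-elim)
open import Relation.Nullary using (¬_)
open import Relation.Binary.PropositionalEquality using (_≡_; _≢_; refl; sym; trans; cong)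
open import Data.List.Relation.Binary.Prefix.Heterogeneous using ([]; _∷_)

open import Defs

module _ {G₁ G₂ : TermGraph} {h : V G₁ → V G₂} where

  hoHom-maps-scope : ∀ {Sc₁ Sc₂} → IsHoHom G₁ G₂ Sc₁ Sc₂ h →
                     ∀ {v u} → lab G₁ v ≡ lam → Sc₁ v u → Sc₂ (h v) (h u)
  hoHom-maps-scope (_ , scopes) {v} {u} v-lam u∈Sc = proj₂ (scopes v v-lam (h u)) (u , u∈Sc , refl)

  apHom-identifies-prefixes : ∀ {P₁ P₂} → IsApHom G₁ G₂ P₁ P₂ h →
                              ∀ {u w} → h u ≡ h w → map h (P₁ u) ≡ map h (P₁ w)
  apHom-identifies-prefixes {P₂ = P₂} (_ , prefixes) {u} {w} hu≡hw =
    trans (sym (prefixes u)) (trans (cong P₂ hu≡hw) (prefixes w))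

root-successor-∉-scope : ∀ {G Sc} → IsScopeFunction G Sc →
                         ∀ {v k w} → IsV-lam G v → root G ≢ v →
                         At (args G (root G)) k w → ¬ Sc⁻ G Sc v w
root-successor-∉-scope {G} isSc {v} {k} {w} v-lam root≢v edge w∈Sc⁻ =
  IsScopeFunction.sc-root isSc v v-lam
    (IsScopeFunction.sc-close isSc v (root G) k w v-lam edge w∈Sc⁻ , root≢v)

data Vertex : Set where
  top absX absY varY absZ varZ : Vertex

labelOf : Vertex → Lab
labelOf top  = app
labelOf absX = lam
labelOf absY = lam
labelOf varY = var0
labelOf absZ = lam
labelOf varZ = var0

argsOf : Vertex → List Vertex
argsOf top  = absX ∷ absZ ∷ []
argsOf absX = absY ∷ []
argsOf absY = varY ∷ []
argsOf varY = absY ∷ []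
argsOf absZ = varZ ∷ []
argsOf varZ = absZ ∷ []

unshared : TermGraph
unshared = record
  { V = Vertex ; lab = labelOf ; args = argsOf ; args-len = arities ; root = top ; reachable = reach }
  where
  arities : ∀ v → length (argsOf v) ≡ arity (labelOf v)
  arities top  = refl
  arities absX = refl
  arities absY = refl
  arities varY = refl
  arities absZ = refl
  arities varZ = refl

  reach : ∀ v → Reach argsOf top v
  reach top  = reach-root
  reach absX = reach-step reach-root here
  reach absY = reach-step (reach-step reach-root here) here
  reach varY = reach-step (reach-step (reach-step reach-root here) here) here
  reach absZ = reach-step reach-root (there here)
  reach varZ = reach-step (reach-step reach-root (there here)) here

data Scope : Vertex → Vertex → Set where
  absX∋absX : Scope absX absX
  absX∋absY : Scope absX absY
  absX∋varY : Scope absX varY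
  absY∋absY : Scope absY absY
  absY∋varY : Scope absY varY
  absZ∋absZ : Scope absZ absZ
  absZ∋varZ : Scope absZ varZ

scope-isScopeFunction : IsScopeFunction unshared Scope
scope-isScopeFunction = record
  { sc-root = λ { _ _ (() , _) }
  ; sc-self = self
  ; sc-nest = nest
  ; sc-close = close
  ; sc-var = binder
  ; sc-var-lam = bound
  }
  where
  self : ∀ v → labelOf v ≡ lam → Scope v v
  self absX _ = absX∋absX
  self absY _ = absY∋absY
  self absZ _ = absZ∋absZ

  nest : ∀ v₀ v₁ → labelOf v₀ ≡ lam → labelOf v₁ ≡ lam →
         Sc⁻ unshared Scope v₀ v₁ → ∀ u → Scope v₁ u → Sc⁻ unshared Scope v₀ u
  nest _ _ _ _ (absX∋absX , ≢) _ _         = ⊥-elim (≢ refl)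
  nest _ _ _ _ (absX∋absY , _) _ absY∋absY = absX∋absY , λ ()
  nest _ _ _ _ (absX∋absY , _) _ absY∋varY = absX∋varY , λ ()
  nest _ _ _ () (absX∋varY , _) _ _
  nest _ _ _ _ (absY∋absY , ≢) _ _         = ⊥-elim (≢ refl)
  nest _ _ _ () (absY∋varY , _) _ _
  nest _ _ _ _ (absZ∋absZ , ≢) _ _         = ⊥-elim (≢ refl)
  nest _ _ _ () (absZ∋varZ , _) _ _

  close : ∀ v w k wₖ → labelOf v ≡ lam → At (argsOf w) k wₖ →
          Sc⁻ unshared Scope v wₖ → Scope v w
  close _ top  _ _ _ here         (absX∋absX , ≢) = ⊥-elim (≢ refl)
  close _ top  _ _ _ (there here) (absZ∋absZ , ≢) = ⊥-elim (≢ refl)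
  close _ absX _ _ _ here         (absX∋absY , _) = absX∋absX
  close _ absX _ _ _ here         (absY∋absY , ≢) = ⊥-elim (≢ refl)
  close _ absY _ _ _ here         (absX∋varY , _) = absX∋absY
  close _ absY _ _ _ here         (absY∋varY , _) = absY∋absY
  close _ varY _ _ _ here         (absX∋absY , _) = absX∋varY
  close _ varY _ _ _ here         (absY∋absY , ≢) = ⊥-elim (≢ refl)
  close _ absZ _ _ _ here         (absZ∋varZ , _) = absZ∋absZ
  close _ varZ _ _ _ here         (absZ∋absZ , ≢) = ⊥-elim (≢ refl)

  binder : ∀ w → labelOf w ≡ var0 → Σ Vertex λ v₀ → labelOf v₀ ≡ lam × Sc⁻ unshared Scope v₀ w
  binder varY _ = absY , refl , absY∋varY , λ ()
  binder varZ _ = absZ , refl , absZ∋varZ , λ ()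

  bound : ∀ w w₀ → labelOf w ≡ var0 → At (argsOf w) 0 w₀ →
          labelOf w₀ ≡ lam ×
          (∀ v → labelOf v ≡ lam → (Scope v w → Scope v w₀) × (Scope v w₀ → Scope v w))
  bound varY _ _ here = refl , λ _ _ →
    (λ { absX∋varY → absX∋absY ; absY∋varY → absY∋absY }) ,
    (λ { absX∋absY → absX∋varY ; absY∋absY → absY∋varY })
  bound varZ _ _ here = refl , λ _ _ →
    (λ { absZ∋varZ → absZ∋absZ }) , (λ { absZ∋absZ → absZ∋varZ })

prefixOf : Vertex → List Vertex
prefixOf top  = []
prefixOf absX = []
prefixOf absY = absX ∷ []
prefixOf varY = absX ∷ absY ∷ []
prefixOf absZ = []
prefixOf varZ = absZ ∷ []

prefix-isAbsPrefixFunction : IsAbsPrefixFunction unshared prefixOf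
prefix-isAbsPrefixFunction = record
  { ap-root = refl
  ; ap-lam = λ { absX _ _ here → refl ∷ [] ; absY _ _ here → refl ∷ refl ∷ [] ; absZ _ _ here → refl ∷ [] }
  ; ap-app = λ { top _ _ _ here → [] ; top _ _ _ (there here) → [] }
  ; ap-var = λ { varY _ () ; varZ _ () }
  ; ap-var-lam = λ { varY _ _ here → refl , refl ; varZ _ _ here → refl , refl }
  }

data Vertex' : Set where
  top' absX' absI varI : Vertex'

labelOf' : Vertex' → Lab
labelOf' top'  = app
labelOf' absX' = lam
labelOf' absI  = lam
labelOf' varI  = var0

argsOf' : Vertex' → List Vertex'
argsOf' top'  = absX' ∷ absI ∷ []
argsOf' absX' = absI ∷ []
argsOf' absI  = varI ∷ []
argsOf' varI  = absI ∷ []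

shared : TermGraph
shared = record
  { V = Vertex' ; lab = labelOf' ; args = argsOf' ; args-len = arities ; root = top' ; reachable = reach }
  where
  arities : ∀ v → length (argsOf' v) ≡ arity (labelOf' v)
  arities top'  = refl
  arities absX' = refl
  arities absI  = refl
  arities varI  = refl

  reach : ∀ v → Reach argsOf' top' v
  reach top'  = reach-root
  reach absX' = reach-step reach-root here
  reach absI  = reach-step reach-root (there here)
  reach varI  = reach-step (reach-step reach-root (there here)) here

share : Vertex → Vertex'
share top  = top'
share absX = absX'
share absY = absI
share varY = varI
share absZ = absI
share varZ = varI

share-isHom : IsHom unshared shared share
share-isHom = record { hom-root = refl ; hom-lab = labels ; hom-args = arguments }
  where
  labels : ∀ v → labelOf' (share v) ≡ labelOf v
  labels top  = refl
  labels absX = refl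
  labels absY = refl
  labels varY = refl
  labels absZ = refl
  labels varZ = refl

  arguments : ∀ v → argsOf' (share v) ≡ map share (argsOf v)
  arguments top  = refl
  arguments absX = refl
  arguments absY = refl
  arguments varY = refl
  arguments absZ = refl
  arguments varZ = refl

proposition4p11 :
    (Σ TermGraph λ G → Σ (V G → V G → Set) λ Sc → IsScopeFunction G Sc ×
      Σ TermGraph λ G' → Σ (V G → V G') λ h → IsHom G G' h ×
        ¬ (Σ (V G' → V G' → Set) λ Sc' → IsScopeFunction G' Sc' × IsHoHom G G' Sc Sc' h))
    ×
    (Σ TermGraph λ G → Σ (V G → List (V G)) λ P → IsAbsPrefixFunction G P ×
      Σ TermGraph λ G' → Σ (V G → V G') λ h → IsHom G G' h ×
        ¬ (Σ (V G' → List (V G')) λ P' → IsAbsPrefixFunction G' P' × IsApHom G G' P P' h))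
proposition4p11 =
  (unshared , Scope , scope-isScopeFunction , shared , share , share-isHom , no-scope) ,
  (unshared , prefixOf , prefix-isAbsPrefixFunction , shared , share , share-isHom , no-prefix)
  where
  no-scope : ¬ (Σ (Vertex' → Vertex' → Set) λ Sc' →
                IsScopeFunction shared Sc' × IsHoHom unshared shared Scope Sc' share)
  no-scope (Sc' , isSc' , hoHom) =
    root-successor-∉-scope {shared} {Sc'} isSc' {absX'} refl (λ ()) (there here)
      (hoHom-maps-scope {h = share} {Sc₂ = Sc'} hoHom refl absX∋absY , λ ())

  no-prefix : ¬ (Σ (Vertex' → List Vertex') λ P' →
                 IsAbsPrefixFunction shared P' × IsApHom unshared shared prefixOf P' share)
  no-prefix (P' , _ , apHom) with apHom-identifies-prefixes {h = share} {P₂ = P'} apHom {absY} {absZ} refl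
  ... | ()
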